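{- Let $n\ge3$ be odd, let $f,B_0,C$ be nonzero integers with $B_0$ squarefree and $\gcd(f,C)=1$, and put $B=f^2B_0$. Let $p$ be an odd prime and $r>0$. If $[x:y:z]\in\mathcal{Y}_{B,C}(\mathbb{Z};*_p^r)$, then $p^r\mid x$ and exactly one of the following holds: (a) $p^r\mid y$, $p^{2r}\mid C$, and $p\nmid z$; (b) $p\nmid y$, $p^r\mid f$, and $p^{\lceil 2r/n\rceil}\mid z$. Moreover, in case (b), if $n\nmid r$ then $p^r\,\|\,f$.
   Context: $\mathcal{Y}_{B,C}(\mathbb{Z})$ denotes the set (groupoid) of primitive integer solutions $[x:y:z]$ of $x^2+By^2=Cz^n$ (modulo $(x,y,z)\sim(-x,-y,z)$). Let $K=\mathbb{Q}(\sqrt{ -B_0})$ with ring of integers $\mathcal{O}_K$; for an object put $u=x+f\sqrt{ -B_0}\,y\in\mathcal{O}_K$. For a prime $p$ and $r\ge0$, write $p^r\|u$ if $u\in p^r\mathcal{O}_K\smallsetminus p^{r+1}\mathcal{O}_K$; the condition $*_p^r$ means $p^r\|u$, and $\mathcal{Y}_{B,C}(\mathbb{Z};*_p^r)$ is the subgroupoid of objects satisfying it. For integers, $p^r\|f$ means $v_p(f)=r$. -}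

module Defs where

open import Data.Nat as ℕ using (ℕ)
open import Data.Integer as ℤ using (ℤ; +_; -[1+_]; _+_; _*_; _^_; ∣_∣)
open import Data.Integer.Divisibility using (_∣_)
open import Data.Integer.GCD using (gcd)
open import Data.Product using (_×_)
open import Relation.Binary.PropositionalEquality using (_≡_)
open import Relation.Nullary using (¬_)

Squarefree : ℤ → Set
Squarefree b = ∀ (d : ℤ) → (d * d) ∣ b → ∣ d ∣ ≡ 1

-- Ceiling division ⌈ a / b ⌉ for b > 0 (b given as suc k).
ceilDiv : ℕ → ℕ → ℕ
ceilDiv a k = (a ℕ.+ k) ℕ./ ℕ.suc k


exactPow : ℕ → ℕ → ℤ → Set
exactPow p r f = ((+ p) ^ r ∣ f) × ¬ ((+ p) ^ (ℕ.suc r) ∣ f)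

-- Membership of u = a + b√(-B₀) in m·𝒪_K, K = ℚ(√(-B₀)) a quadratic field
-- (B₀ squarefree, B₀ ≠ -1).  u ∈ m𝒪_K  iff  u/m ∈ 𝒪_K  iff  u/m is integral
-- over ℤ, i.e. its trace 2a/m and norm (a² + B₀ b²)/m² lie in ℤ.
InMOK : (B₀ m a b : ℤ) → Set
InMOK B₀ m a b = (m ∣ (+ 2) * a) × ((m * m) ∣ (a * a + B₀ * (b * b)))

-- p^r ∥ u for u = x + f√(-B₀) y, i.e. u ∈ p^r𝒪_K ∖ p^{r+1}𝒪_K  (condition *_p^r).
StarCond : (B₀ f : ℤ) (p r : ℕ) (x y : ℤ) → Set
StarCond B₀ f p r x y =
  InMOK B₀ ((+ p) ^ r) x (f * y) × ¬ InMOK B₀ ((+ p) ^ (ℕ.suc r)) x (f * y)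

IsSolution : (B C : ℤ) (n : ℕ) (x y z : ℤ) → Set
IsSolution B C n x y z =
  (x * x + B * (y * y) ≡ C * z ^ n) × (gcd (gcd x y) z ≡ + 1)

{-# OPTIONS --safe #-}

-- Write u = x + f y √(-B₀), so that N(u) = x² + B₀ (f y)² = C zⁿ.  Since p is odd and B₀ is
-- squarefree, u ∈ pʳ𝒪_K forces pʳ ∣ x and pʳ ∣ f y, hence p²ʳ ∣ C zⁿ.  If p ∣ y, primitivity
-- gives p ∤ z, so p²ʳ ∣ C, so p ∤ f by gcd(f, C) = 1, so pʳ ∣ y.  If p ∤ y, then pʳ ∣ f, so
-- p ∤ C, so p²ʳ ∣ zⁿ and p^⌈2r/n⌉ ∣ z.  In the latter case, if moreover p^(r+1) ∣ f and n ∤ r,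
-- then n ∤ 2r (n is odd), so n⌈2r/n⌉ > 2r and p^(2r+1) ∣ x²; thus p^(r+1) ∣ x and
-- u ∈ p^(r+1)𝒪_K, contradicting *_p^r.  Every valuation bound used is an instance of: if
-- p^s ∤ a and p^t ∣ a mᵉ, then p^j ∣ m as soon as (j - 1) e + s ≤ t.

module Submission where

open import Defs
open import Data.Nat as ℕ using (ℕ; zero; suc; _≥_; _>_)
open import Data.Nat.Primality using (Prime)
import Data.Nat.Divisibility as ℕD
open import Data.Product using (_×_; _,_; proj₁; proj₂)
open import Data.Sum using (_⊎_; inj₁; inj₂)
open import Function using (_∘_)
open import Relation.Binary.PropositionalEquality
  using (_≡_; _≢_; refl; sym; trans; cong; cong₂; subst; subst₂; module ≡-Reasoning)
open import Relation.Nullary using (¬_; Dec; yes; no; contradiction)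

exactly-one-by : ∀ {A B Q : Set} → Dec Q → (Q → A) → (¬ Q → B) → (A → Q) → (B → ¬ Q) →
  A × ¬ B ⊎ B × ¬ A
exactly-one-by (yes q)  q⇒a _    _   b⇒¬q = inj₁ (q⇒a q , λ b → b⇒¬q b q)
exactly-one-by (no ¬q)  _   ¬q⇒b a⇒q _    = inj₂ (¬q⇒b ¬q , ¬q ∘ a⇒q)

module ℕ-Divisibility where

  open import Data.Nat.Base
  open import Data.Nat.Properties
  open import Data.Nat.Divisibility
  open import Data.Nat.Coprimality as Coprimality using (Coprime; coprime-divisor)
  open import Data.Nat.DivMod using (_%_; m≡m%n+[m/n]*n; m%n<n; m/n*n≤m)
  open import Data.Nat.Primality
    using (Prime; euclidsLemma; prime⇒nonTrivial; prime⇒irreducible; prime[2])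
  open import Relation.Nullary.Decidable using (decidable-stable)
  import Algebra.Properties.CommutativeSemigroup as CommSemigroupProperties
  open CommSemigroupProperties +-commutativeSemigroup
    using () renaming (x∙yz≈y∙xz to m+[n+o]≡n+[m+o])
  open CommSemigroupProperties *-commutativeSemigroup
    using () renaming (x∙yz≈z∙xy to m*[n*o]≡o*[m*n])

  ^-distrib-* : ∀ m n o → (m * n) ^ o ≡ m ^ o * n ^ o
  ^-distrib-* m n zero    = refl
  ^-distrib-* m n (suc o) =
    trans (cong (m * n *_) (^-distrib-* m n o)) ([m*n]*[o*p]≡[m*o]*[n*p] m n (m ^ o) (n ^ o))

  m^i∣m^j : ∀ m {i j} → i ≤ j → m ^ i ∣ m ^ j
  m^i∣m^j m {i} {j} i≤j = divides (m ^ (j ∸ i)) (begin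
    m ^ j               ≡⟨ cong (m ^_) (m+[n∸m]≡n i≤j) ⟨
    m ^ (i + (j ∸ i))   ≡⟨ ^-distribˡ-+-* m i (j ∸ i) ⟩
    m ^ i * m ^ (j ∸ i) ≡⟨ *-comm (m ^ i) _ ⟩
    m ^ (j ∸ i) * m ^ i ∎)
    where open ≡-Reasoning

  m^t∣m^e*n⇒m^[t∸e]∣n : ∀ m .{{_ : NonZero m}} t e {n} → m ^ t ∣ m ^ e * n → m ^ (t ∸ e) ∣ n
  m^t∣m^e*n⇒m^[t∸e]∣n m t e {n} m^t∣m^e*n with ≤-total e t
  ... | inj₁ e≤t =
    *-cancelˡ-∣ (m ^ e) {{m^n≢0 m e}} (subst (_∣ m ^ e * n) m^t≡m^e*m^[t∸e] m^t∣m^e*n)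
    where
    m^t≡m^e*m^[t∸e] : m ^ t ≡ m ^ e * m ^ (t ∸ e)
    m^t≡m^e*m^[t∸e] = trans (cong (m ^_) (sym (m+[n∸m]≡n e≤t))) (^-distribˡ-+-* m e (t ∸ e))
  ... | inj₂ t≤e rewrite m≤n⇒m∸n≡0 t≤e = 1∣ n

  module _ {p : ℕ} (p-prime : Prime p) where

    private instance
      p-nonZero : NonZero p
      p-nonZero = nonTrivial⇒nonZero p {{prime⇒nonTrivial p-prime}}

    p≢1 : p ≢ 1
    p≢1 = nonTrivial⇒≢1 {{prime⇒nonTrivial p-prime}}

    p∤1 : ¬ p ∣ 1
    p∤1 = p≢1 ∘ ∣1⇒≡1

    p∣q⇒p≡q : ∀ {q} → Prime q → p ∣ q → p ≡ q
    p∣q⇒p≡q q-prime p∣q with prime⇒irreducible q-prime p∣q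
    ... | inj₁ p≡1 = contradiction p≡1 p≢1
    ... | inj₂ p≡q = p≡q

    p∣m^e⇒p∣m : ∀ {m} e → p ∣ m ^ e → p ∣ m
    p∣m^e⇒p∣m zero p∣1 = contradiction p∣1 p∤1
    p∣m^e⇒p∣m {m} (suc e) p∣m*m^e with euclidsLemma m (m ^ e) p-prime p∣m*m^e
    ... | inj₁ p∣m   = p∣m
    ... | inj₂ p∣m^e = p∣m^e⇒p∣m e p∣m^e

    p^k∣m*n∧p∤m⇒p^k∣n : ∀ k {m n} → ¬ p ∣ m → p ^ k ∣ m * n → p ^ k ∣ n
    p^k∣m*n∧p∤m⇒p^k∣n zero {n = n} _ _ = 1∣ n
    p^k∣m*n∧p∤m⇒p^k∣n (suc k) {m} {n} p∤m p^[1+k]∣m*n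
      with euclidsLemma m n p-prime (m*n∣⇒m∣ p (p ^ k) p^[1+k]∣m*n)
    ... | inj₁ p∣m = contradiction p∣m p∤m
    ... | inj₂ (divides q refl) = subst (p ^ suc k ∣_) (*-comm p q) (*-monoʳ-∣ p p^k∣q)
      where
      p^k∣q : p ^ k ∣ q
      p^k∣q = p^k∣m*n∧p∤m⇒p^k∣n k p∤m
        (*-cancelˡ-∣ p (subst (p * p ^ k ∣_) (m*[n*o]≡o*[m*n] m q p) p^[1+k]∣m*n))

    p^k∣m*n∧p∤n⇒p^k∣m : ∀ k {m n} → ¬ p ∣ n → p ^ k ∣ m * n → p ^ k ∣ m
    p^k∣m*n∧p∤n⇒p^k∣m k {m} {n} p∤n = p^k∣m*n∧p∤m⇒p^k∣n k p∤n ∘ subst (p ^ k ∣_) (*-comm m n)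

    p^t∣a*m^e⇒p∣m : ∀ {a s t m} e → ¬ p ^ s ∣ a → s ≤ t → p ^ t ∣ a * m ^ e → p ∣ m
    p^t∣a*m^e⇒p∣m {t = t} {m} e p^s∤a s≤t p^t∣a*m^e = decidable-stable (p ∣? m) λ p∤m →
      p^s∤a (∣-trans (m^i∣m^j p s≤t) (p^k∣m*n∧p∤n⇒p^k∣m t (p∤m ∘ p∣m^e⇒p∣m e) p^t∣a*m^e))

    -- The bound s + j * e ≤ e + t is (j - 1) e + s ≤ t without truncated subtraction.
    p^t∣a*m^e⇒p^j∣m : ∀ {a s e} j {t m} → ¬ p ^ s ∣ a → s + j * e ≤ e + t →
      p ^ t ∣ a * m ^ e → p ^ j ∣ m
    p^t∣a*m^e⇒p^j∣m zero {m = m} _ _ _ = 1∣ m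
    p^t∣a*m^e⇒p^j∣m {a} {s} {e} (suc i) {t} p^s∤a s+[1+i]e≤e+t p^t∣a*m^e =
      peel (p^t∣a*m^e⇒p∣m e p^s∤a (m+n≤o⇒m≤o s s+ie≤t) p^t∣a*m^e) p^t∣a*m^e
      where
      s+ie≤t : s + i * e ≤ t
      s+ie≤t = +-cancelˡ-≤ e _ _ (subst (_≤ e + t) (m+[n+o]≡n+[m+o] s e (i * e)) s+[1+i]e≤e+t)
      peel : ∀ {m} → p ∣ m → p ^ t ∣ a * m ^ e → p ^ suc i ∣ m
      peel (divides w refl) p^t∣a*[w*p]^e = subst (p ^ suc i ∣_) (*-comm p w) (*-monoʳ-∣ p p^i∣w)
        where
        a*[w*p]^e≡p^e*[a*w^e] : a * (w * p) ^ e ≡ p ^ e * (a * w ^ e)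
        a*[w*p]^e≡p^e*[a*w^e] =
          trans (cong (a *_) (^-distrib-* w p e)) (m*[n*o]≡o*[m*n] a (w ^ e) (p ^ e))
        p^i∣w : p ^ i ∣ w
        p^i∣w = p^t∣a*m^e⇒p^j∣m i p^s∤a (≤-trans s+ie≤t (m≤n+m∸n t e))
          (m^t∣m^e*n⇒m^[t∸e]∣n p t e (subst (p ^ t ∣_) a*[w*p]^e≡p^e*[a*w^e] p^t∣a*[w*p]^e))

    p^t∣m^e⇒p^j∣m : ∀ {e} j {t m} → j * e < e + t → p ^ t ∣ m ^ e → p ^ j ∣ m
    p^t∣m^e⇒p^j∣m {e} j {t} {m} je<e+t =
      p^t∣a*m^e⇒p^j∣m j (p∤1 ∘ subst (_∣ 1) (*-identityʳ p)) je<e+t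
        ∘ subst (p ^ t ∣_) (sym (*-identityˡ (m ^ e)))

    p^r*p^r∣a*[m*m]⇒p^r∣m : ∀ r {a m} → ¬ p * p ∣ a → p ^ r * p ^ r ∣ a * (m * m) → p ^ r ∣ m
    p^r*p^r∣a*[m*m]⇒p^r∣m r {a} {m} p²∤a = p^t∣a*m^e⇒p^j∣m r {t = r + r}
      (p²∤a ∘ subst (_∣ a) (cong (p *_) (*-identityʳ p)))
      (≤-reflexive (cong (2 +_) (trans (*-comm r 2) (cong (r +_) (+-identityʳ r)))))
      ∘ subst₂ _∣_ (sym (^-distribˡ-+-* p r r)) (cong (λ k → a * (m * k)) (sym (*-identityʳ m)))

  prime∧∤⇒coprime : ∀ {q n} → Prime q → ¬ q ∣ n → Coprime q n
  prime∧∤⇒coprime q-prime q∤n (d∣q , d∣n) with prime⇒irreducible q-prime d∣q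
  ... | inj₁ d≡1 = d≡1
  ... | inj₂ refl = contradiction d∣n q∤n

  2∤n∧n∤m⇒n∤2*m : ∀ {n m} → ¬ 2 ∣ n → ¬ n ∣ m → ¬ n ∣ 2 * m
  2∤n∧n∤m⇒n∤2*m 2∤n n∤m = n∤m ∘ coprime-divisor (Coprimality.sym (prime∧∤⇒coprime prime[2] 2∤n))

  ceilDiv[t,k]*[1+k]<1+k+t : ∀ t k → ceilDiv t k * suc k < suc k + t
  ceilDiv[t,k]*[1+k]<1+k+t t k =
    s≤s (≤-trans (m/n*n≤m (t + k) (suc k)) (≤-reflexive (+-comm t k)))

  t≤ceilDiv[t,k]*[1+k] : ∀ t k → t ≤ ceilDiv t k * suc k
  t≤ceilDiv[t,k]*[1+k] t k = +-cancelʳ-≤ k t _ (begin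
    t + k                                 ≡⟨ m≡m%n+[m/n]*n (t + k) (suc k) ⟩
    (t + k) % suc k + ceilDiv t k * suc k ≤⟨ +-monoˡ-≤ _ (m<1+n⇒m≤n (m%n<n (t + k) (suc k))) ⟩
    k + ceilDiv t k * suc k               ≡⟨ +-comm k _ ⟩
    ceilDiv t k * suc k + k               ∎)
    where open ≤-Reasoning

  [1+k]∤t⇒t<ceilDiv[t,k]*[1+k] : ∀ t k → ¬ suc k ∣ t → t < ceilDiv t k * suc k
  [1+k]∤t⇒t<ceilDiv[t,k]*[1+k] t k [1+k]∤t =
    ≤∧≢⇒< (t≤ceilDiv[t,k]*[1+k] t k) ([1+k]∤t ∘ divides (ceilDiv t k))

open ℕ-Divisibility

-- The statement's unsigned divisibility is ℕ-divisibility of absolute values, through which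
-- the lemmas above are transferred; intermediate steps use signed divisibility, a record
-- whose indices Agda can infer.
open import Data.Nat.Primality using (prime[2])
open import Data.Integer as ℤ using (ℤ; +_; -[1+_]; _+_; _*_; _^_; ∣_∣)
open import Data.Integer.Divisibility using (_∣_)
open import Data.Integer.GCD using (gcd; gcd-greatest)
import Data.Integer.Properties as ℤ
import Data.Nat.Properties as ℕ
open import Data.Integer.Divisibility.Signed as Signed
  using (∣ᵤ⇒∣; ∣⇒∣ᵤ; _∣?_) renaming (_∣_ to _∣ˢ_)
open import Data.Integer.Tactic.RingSolver using (solve-∀)

abs-^ : ∀ i n → ∣ i ^ n ∣ ≡ ∣ i ∣ ℕ.^ n
abs-^ i zero    = refl
abs-^ i (suc n) = trans (ℤ.abs-* i (i ^ n)) (cong (∣ i ∣ ℕ.*_) (abs-^ i n))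

i^[2*r]≡i^r*i^r : ∀ i r → i ^ (2 ℕ.* r) ≡ i ^ r * i ^ r
i^[2*r]≡i^r*i^r i r =
  trans (ℤ.^-distribˡ-+-* i r (r ℕ.+ 0)) (cong (λ k → i ^ r * i ^ k) (ℕ.+-identityʳ r))

i^2≡i*i : ∀ i → i ^ 2 ≡ i * i
i^2≡i*i i = cong (i *_) (ℤ.*-identityʳ i)

*-pres-∣ : ∀ {i j k l} → i ∣ˢ j → k ∣ˢ l → i * k ∣ˢ j * l
*-pres-∣ {j = j} {k} i∣j k∣l = Signed.∣-trans (Signed.*-monoˡ-∣ k i∣j) (Signed.*-monoʳ-∣ j k∣l)

i∣j⇒i^n∣j^n : ∀ {i j} n → i ∣ˢ j → i ^ n ∣ˢ j ^ n
i∣j⇒i^n∣j^n zero    _   = Signed.∣-refl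
i∣j⇒i^n∣j^n (suc n) i∣j = *-pres-∣ i∣j (i∣j⇒i^n∣j^n n i∣j)

i^m∣i^n : ∀ i {m n} → m ℕ.≤ n → i ^ m ∣ˢ i ^ n
i^m∣i^n i {m} {n} = ∣ᵤ⇒∣ ∘ subst₂ ℕD._∣_ (sym (abs-^ i m)) (sym (abs-^ i n)) ∘ m^i∣m^j ∣ i ∣

i∣i^n : ∀ i {n} → n > 0 → i ∣ˢ i ^ n
i∣i^n i {suc n} _ = Signed.∣m⇒∣m*n (i ^ n) Signed.∣-refl

norm : ℤ → ℤ → ℤ → ℤ
norm B₀ a b = a * a + B₀ * (b * b)

x²+f²B₀y²≡norm : ∀ B₀ f x y → x * x + f * f * B₀ * (y * y) ≡ norm B₀ x (f * y)
x²+f²B₀y²≡norm = ring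
  where
  ring : ∀ B₀ f x y → x * x + f * f * B₀ * (y * y) ≡ x * x + B₀ * (f * y * (f * y))
  ring = solve-∀

∣i∧∣j⇒∣gcd : ∀ {i j k} → k ∣ˢ i → k ∣ˢ j → k ∣ˢ gcd i j
∣i∧∣j⇒∣gcd {i} {j} {k} k∣i k∣j = ∣ᵤ⇒∣ (gcd-greatest {i} {j} {k} (∣⇒∣ᵤ k∣i) (∣⇒∣ᵤ k∣j))

∣x∧∣m⇒InMOK : ∀ {B₀ d x m} → d ∣ˢ x → d ∣ˢ m → InMOK B₀ d x m
∣x∧∣m⇒InMOK {B₀} d∣x d∣m = ∣⇒∣ᵤ (Signed.∣n⇒∣m*n (+ 2) d∣x)
  , ∣⇒∣ᵤ (Signed.∣m∣n⇒∣m+n (*-pres-∣ d∣x d∣x) (Signed.∣n⇒∣m*n B₀ (*-pres-∣ d∣m d∣m)))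

module _ {p : ℕ} (p-prime : Prime p) where

  private
    P : ℤ
    P = + p

    p^k∣ˢi⇒p^k∣∣i∣ : ∀ {k i} → P ^ k ∣ˢ i → p ℕ.^ k ℕD.∣ ∣ i ∣
    p^k∣ˢi⇒p^k∣∣i∣ {k} = subst (ℕD._∣ _) (abs-^ P k) ∘ ∣⇒∣ᵤ

    p^k∣∣i∣⇒p^k∣ˢi : ∀ {k i} → p ℕ.^ k ℕD.∣ ∣ i ∣ → P ^ k ∣ˢ i
    p^k∣∣i∣⇒p^k∣ˢi {k} = ∣ᵤ⇒∣ ∘ subst (ℕD._∣ _) (sym (abs-^ P k))

  p∣i^e⇒p∣i : ∀ {i} e → P ∣ˢ i ^ e → P ∣ˢ i
  p∣i^e⇒p∣i {i} e = ∣ᵤ⇒∣ ∘ p∣m^e⇒p∣m p-prime e ∘ subst (p ℕD.∣_) (abs-^ i e) ∘ ∣⇒∣ᵤ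

  p^k∣i*j∧p∤i⇒p^k∣j : ∀ k {i j} → ¬ P ∣ˢ i → P ^ k ∣ˢ i * j → P ^ k ∣ˢ j
  p^k∣i*j∧p∤i⇒p^k∣j k {i} {j} p∤i =
    p^k∣∣i∣⇒p^k∣ˢi {k} {j} ∘ p^k∣m*n∧p∤m⇒p^k∣n p-prime k (p∤i ∘ ∣ᵤ⇒∣)
      ∘ subst (_ ℕD.∣_) (ℤ.abs-* i j) ∘ p^k∣ˢi⇒p^k∣∣i∣ {k} {i * j}

  p^k∣i*j∧p∤j⇒p^k∣i : ∀ k {i j} → ¬ P ∣ˢ j → P ^ k ∣ˢ i * j → P ^ k ∣ˢ i
  p^k∣i*j∧p∤j⇒p^k∣i k {i} {j} p∤j = p^k∣i*j∧p∤i⇒p^k∣j k p∤j ∘ subst (P ^ k ∣ˢ_) (ℤ.*-comm i j)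

  p^t∣i^e⇒p^j∣i : ∀ {e} j {t i} → j ℕ.* e ℕ.< e ℕ.+ t → P ^ t ∣ˢ i ^ e → P ^ j ∣ˢ i
  p^t∣i^e⇒p^j∣i {e} j {t} {i} je<e+t =
    p^k∣∣i∣⇒p^k∣ˢi {j} {i} ∘ p^t∣m^e⇒p^j∣m p-prime j je<e+t
      ∘ subst (_ ℕD.∣_) (abs-^ i e) ∘ p^k∣ˢi⇒p^k∣∣i∣ {t} {i ^ e}

  p^r*p^r∣a*[i*i]⇒p^r∣i : ∀ r {a i} → ¬ P * P ∣ˢ a → P ^ r * P ^ r ∣ˢ a * (i * i) → P ^ r ∣ˢ i
  p^r*p^r∣a*[i*i]⇒p^r∣i r {a} {i} p²∤a =
    p^k∣∣i∣⇒p^k∣ˢi {r} {i}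
      ∘ p^r*p^r∣a*[m*m]⇒p^r∣m p-prime r (p²∤a ∘ ∣ᵤ⇒∣ ∘ subst (ℕD._∣ _) (sym (ℤ.abs-* P P)))
      ∘ subst₂ ℕD._∣_ |p^r*p^r|≡p^r*p^r |a*[i*i]|≡|a|*[|i|*|i|] ∘ ∣⇒∣ᵤ
    where
    |p^r*p^r|≡p^r*p^r : ∣ P ^ r * P ^ r ∣ ≡ p ℕ.^ r ℕ.* p ℕ.^ r
    |p^r*p^r|≡p^r*p^r = trans (ℤ.abs-* (P ^ r) (P ^ r)) (cong₂ ℕ._*_ (abs-^ P r) (abs-^ P r))
    |a*[i*i]|≡|a|*[|i|*|i|] : ∣ a * (i * i) ∣ ≡ ∣ a ∣ ℕ.* (∣ i ∣ ℕ.* ∣ i ∣)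
    |a*[i*i]|≡|a|*[|i|*|i|] = trans (ℤ.abs-* a (i * i)) (cong (∣ a ∣ ℕ.*_) (ℤ.abs-* i i))

  gcd≡1∧p∣i⇒p∤j : ∀ {i j} → gcd i j ≡ + 1 → P ∣ˢ i → ¬ P ∣ˢ j
  gcd≡1∧p∣i⇒p∤j gcd≡1 p∣i p∣j = p∤1 p-prime (∣⇒∣ᵤ (subst (P ∣ˢ_) gcd≡1 (∣i∧∣j⇒∣gcd p∣i p∣j)))

  InMOK[p^r]⇒p^r∣x×p^r∣m : ∀ r {B₀ x m} → Squarefree B₀ → p ≢ 2 → InMOK B₀ (P ^ r) x m →
    P ^ r ∣ˢ x × P ^ r ∣ˢ m
  InMOK[p^r]⇒p^r∣x×p^r∣m r {B₀} {x} {m} squarefree p≢2 (p^r∣2x , p^r*p^r∣N) = p^r∣x , p^r∣m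
    where
    p^r∣x : P ^ r ∣ˢ x
    p^r∣x = p^k∣i*j∧p∤i⇒p^k∣j r {+ 2} (p≢2 ∘ p∣q⇒p≡q p-prime prime[2] ∘ ∣⇒∣ᵤ) (∣ᵤ⇒∣ p^r∣2x)
    p^r∣m : P ^ r ∣ˢ m
    p^r∣m = p^r*p^r∣a*[i*i]⇒p^r∣i r {B₀} (p≢1 p-prime ∘ squarefree P ∘ ∣⇒∣ᵤ)
      (Signed.∣m+n∣m⇒∣n (∣ᵤ⇒∣ p^r*p^r∣N) (*-pres-∣ p^r∣x p^r∣x))

  p^[1+2r]∣norm∧p^[1+r]∣m⇒InMOK : ∀ r {B₀ x m} → P ^ suc (2 ℕ.* r) ∣ˢ norm B₀ x m →
    P ^ suc r ∣ˢ m → InMOK B₀ (P ^ suc r) x m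
  p^[1+2r]∣norm∧p^[1+r]∣m⇒InMOK r {B₀} {x} {m} p^[1+2r]∣N p^[1+r]∣m =
    ∣x∧∣m⇒InMOK {B₀} p^[1+r]∣x p^[1+r]∣m
    where
    1+2r≤2[1+r] : suc (2 ℕ.* r) ℕ.≤ 2 ℕ.* suc r
    1+2r≤2[1+r] = subst (suc (2 ℕ.* r) ℕ.≤_) (sym (ℕ.*-suc 2 r)) (ℕ.n≤1+n _)
    p^[1+2r]∣B₀m² : P ^ suc (2 ℕ.* r) ∣ˢ B₀ * (m * m)
    p^[1+2r]∣B₀m² = Signed.∣n⇒∣m*n B₀ (Signed.∣-trans (i^m∣i^n P 1+2r≤2[1+r])
      (subst (_∣ˢ m * m) (sym (i^[2*r]≡i^r*i^r P (suc r))) (*-pres-∣ p^[1+r]∣m p^[1+r]∣m)))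
    p^[1+r]∣x : P ^ suc r ∣ˢ x
    p^[1+r]∣x = p^t∣i^e⇒p^j∣i (suc r) (ℕ.≤-reflexive (cong (3 ℕ.+_) (ℕ.*-comm r 2)))
      (subst (P ^ suc (2 ℕ.* r) ∣ˢ_) (sym (i^2≡i*i x))
        (Signed.∣m+n∣n⇒∣m p^[1+2r]∣N p^[1+2r]∣B₀m²))

  p∣y⇒case-a : ∀ {f C x y z n r} → gcd (gcd x y) z ≡ + 1 → gcd f C ≡ + 1 → r > 0 →
    P ^ r ∣ˢ x → P ^ r ∣ˢ f * y → P ^ (2 ℕ.* r) ∣ˢ C * z ^ n → P ∣ˢ y →
    (P ^ r ∣ y) × (P ^ (2 ℕ.* r) ∣ C) × ¬ (P ∣ z)
  p∣y⇒case-a {f} {C} {x} {y} {z} {n} {r} gcd[x,y,z]≡1 gcd[f,C]≡1 r>0 p^r∣x p^r∣fy p^2r∣Czⁿ p∣y =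
    ∣⇒∣ᵤ p^r∣y , ∣⇒∣ᵤ p^2r∣C , p∤z ∘ ∣ᵤ⇒∣
    where
    p∤z : ¬ P ∣ˢ z
    p∤z = gcd≡1∧p∣i⇒p∤j gcd[x,y,z]≡1 (∣i∧∣j⇒∣gcd (Signed.∣-trans (i∣i^n P r>0) p^r∣x) p∣y)
    p^2r∣C : P ^ (2 ℕ.* r) ∣ˢ C
    p^2r∣C = p^k∣i*j∧p∤j⇒p^k∣i (2 ℕ.* r) (p∤z ∘ p∣i^e⇒p∣i n) p^2r∣Czⁿ
    p∤f : ¬ P ∣ˢ f
    p∤f p∣f = gcd≡1∧p∣i⇒p∤j gcd[f,C]≡1 p∣f
      (Signed.∣-trans (i∣i^n P (ℕ.≤-trans r>0 (ℕ.m≤m+n r _))) p^2r∣C)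
    p^r∣y : P ^ r ∣ˢ y
    p^r∣y = p^k∣i*j∧p∤i⇒p^k∣j r p∤f p^r∣fy

  p∤y⇒case-b : ∀ {f C y z k r} → gcd f C ≡ + 1 → r > 0 →
    P ^ r ∣ˢ f * y → P ^ (2 ℕ.* r) ∣ˢ C * z ^ suc k → ¬ P ∣ˢ y →
    ¬ (P ∣ y) × (P ^ r ∣ f) × (P ^ ceilDiv (2 ℕ.* r) k ∣ z)
  p∤y⇒case-b {f} {C} {y} {z} {k} {r} gcd[f,C]≡1 r>0 p^r∣fy p^2r∣Czⁿ p∤y =
    p∤y ∘ ∣ᵤ⇒∣ , ∣⇒∣ᵤ p^r∣f , ∣⇒∣ᵤ p^c∣z
    where
    p^r∣f : P ^ r ∣ˢ f
    p^r∣f = p^k∣i*j∧p∤j⇒p^k∣i r p∤y p^r∣fy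
    p∤C : ¬ P ∣ˢ C
    p∤C = gcd≡1∧p∣i⇒p∤j gcd[f,C]≡1 (Signed.∣-trans (i∣i^n P r>0) p^r∣f)
    p^c∣z : P ^ ceilDiv (2 ℕ.* r) k ∣ˢ z
    p^c∣z = p^t∣i^e⇒p^j∣i (ceilDiv (2 ℕ.* r) k) (ceilDiv[t,k]*[1+k]<1+k+t (2 ℕ.* r) k)
      (p^k∣i*j∧p∤i⇒p^k∣j (2 ℕ.* r) p∤C p^2r∣Czⁿ)

  2∤n∧n∤r⇒p^r∥f : ∀ {B₀ f C x y z k r} → ¬ 2 ℕD.∣ suc k → ¬ suc k ℕD.∣ r →
    norm B₀ x (f * y) ≡ C * z ^ suc k → ¬ InMOK B₀ (P ^ suc r) x (f * y) →
    P ^ r ∣ f → P ^ ceilDiv (2 ℕ.* r) k ∣ z → exactPow p r f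
  2∤n∧n∤r⇒p^r∥f {B₀} {f} {C} {x} {y} {z} {k} {r} 2∤n n∤r N≡Czⁿ u∉p^[1+r] p^r∣f p^c∣z =
    p^r∣f , λ p^[1+r]∣f → u∉p^[1+r] (p^[1+2r]∣norm∧p^[1+r]∣m⇒InMOK r {B₀} {x}
      (subst (P ^ suc (2 ℕ.* r) ∣ˢ_) (sym N≡Czⁿ) p^[1+2r]∣Czⁿ)
      (Signed.∣m⇒∣m*n y (∣ᵤ⇒∣ {P ^ suc r} {f} p^[1+r]∣f)))
    where
    c : ℕ
    c = ceilDiv (2 ℕ.* r) k
    2r<c[1+k] : 2 ℕ.* r ℕ.< c ℕ.* suc k
    2r<c[1+k] = [1+k]∤t⇒t<ceilDiv[t,k]*[1+k] (2 ℕ.* r) k (2∤n∧n∤m⇒n∤2*m 2∤n n∤r)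
    p^[1+2r]∣Czⁿ : P ^ suc (2 ℕ.* r) ∣ˢ C * z ^ suc k
    p^[1+2r]∣Czⁿ = Signed.∣n⇒∣m*n C (Signed.∣-trans (i^m∣i^n P 2r<c[1+k])
      (subst (_∣ˢ z ^ suc k) (ℤ.^-*-assoc P c (suc k))
        (i∣j⇒i^n∣j^n (suc k) (∣ᵤ⇒∣ {P ^ c} {z} p^c∣z))))

lemma4p11 : (n : ℕ) → n ≥ 3 → ¬ (2 ℕD.∣ n) →
    (f B₀ C : ℤ) → f ≢ + 0 → B₀ ≢ + 0 → C ≢ + 0 →
    Squarefree B₀ → B₀ ≢ -[1+ 0 ] → gcd f C ≡ + 1 →
    (p : ℕ) → Prime p → p ≢ 2 → (r : ℕ) → r > 0 →
    (x y z : ℤ) →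
    IsSolution (f * f * B₀) C n x y z →
    StarCond B₀ f p r x y →
    ((+ p) ^ r ∣ x)
    × (( ((+ p) ^ r ∣ y) × ((+ p) ^ (2 ℕ.* r) ∣ C) × ¬ (+ p ∣ z) )
       × ¬ ( ¬ (+ p ∣ y) × ((+ p) ^ r ∣ f) × ((+ p) ^ ceilDiv (2 ℕ.* r) (ℕ.pred n) ∣ z) )
      ⊎ ( ¬ (+ p ∣ y) × ((+ p) ^ r ∣ f) × ((+ p) ^ ceilDiv (2 ℕ.* r) (ℕ.pred n) ∣ z) )
       × ¬ ( ((+ p) ^ r ∣ y) × ((+ p) ^ (2 ℕ.* r) ∣ C) × ¬ (+ p ∣ z) ))
    × ( ( ¬ (+ p ∣ y) × ((+ p) ^ r ∣ f) × ((+ p) ^ ceilDiv (2 ℕ.* r) (ℕ.pred n) ∣ z) ) →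
        ¬ (n ℕD.∣ r) → exactPow p r f )
lemma4p11 (suc k) _ 2∤n f B₀ C _ _ _ squarefree _ gcd[f,C]≡1 p p-prime p≢2 r r>0 x y z
  (x²+By²≡Czⁿ , gcd[x,y,z]≡1) (u∈pʳ , u∉pʳ⁺¹) =
    ∣⇒∣ᵤ p^r∣x
  , exactly-one-by (+ p ∣? y)
      (p∣y⇒case-a p-prime {f} {C} {x} {y} {z} {suc k}
        gcd[x,y,z]≡1 gcd[f,C]≡1 r>0 p^r∣x p^r∣fy p^2r∣Czⁿ)
      (p∤y⇒case-b p-prime {f} {C} {y} {z} gcd[f,C]≡1 r>0 p^r∣fy p^2r∣Czⁿ)
      (λ caseA → Signed.∣-trans (i∣i^n (+ p) r>0) (∣ᵤ⇒∣ (proj₁ caseA)))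
      (λ caseB → proj₁ caseB ∘ ∣⇒∣ᵤ)
  , λ (_ , p^r∣f , p^c∣z) n∤r →
      2∤n∧n∤r⇒p^r∥f p-prime {B₀} {f} {C} {x} {y} {z} 2∤n n∤r N≡Czⁿ u∉pʳ⁺¹ p^r∣f p^c∣z
  where
  N≡Czⁿ : norm B₀ x (f * y) ≡ C * z ^ suc k
  N≡Czⁿ = trans (sym (x²+f²B₀y²≡norm B₀ f x y)) x²+By²≡Czⁿ
  p^r∣x×p^r∣fy : (+ p) ^ r ∣ˢ x × (+ p) ^ r ∣ˢ f * y
  p^r∣x×p^r∣fy = InMOK[p^r]⇒p^r∣x×p^r∣m p-prime r {B₀} squarefree p≢2 u∈pʳ
  p^r∣x : (+ p) ^ r ∣ˢ x
  p^r∣x = proj₁ p^r∣x×p^r∣fy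
  p^r∣fy : (+ p) ^ r ∣ˢ f * y
  p^r∣fy = proj₂ p^r∣x×p^r∣fy
  p^2r∣Czⁿ : (+ p) ^ (2 ℕ.* r) ∣ˢ C * z ^ suc k
  p^2r∣Czⁿ = subst₂ _∣ˢ_ (sym (i^[2*r]≡i^r*i^r (+ p) r)) N≡Czⁿ (∣ᵤ⇒∣ (proj₂ u∈pʳ))
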